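{- Let $\Lambda$ be a finite alphabet and let $\mathcal{P}$ be any symmetric $\Lambda$-valued communication problem that has a constant-cost tandem $\textsc{Equality}$ protocol. Then for every constant $r$ there exists a constant $k$ such that every distance-$r$ composition of $\mathcal{P}$ reduces to $\textsc{HD}_k$; that is, there is a constant $c$ such that every problem $g[P_1\bullet\cdots\bullet P_n]$ (over all $n$, all $P_1,\dots,P_n\in\mathcal{P}$ and all permutation-invariant $g\colon\Lambda^{\le r}\to\Lambda$) satisfies $\mathsf{D}^{\textsc{HD}_k}(g[P_1\bullet\cdots\bullet P_n])\le c$.
   Context: $\mathcal{P}$ is a set of $\Lambda$-valued matrices; it is symmetric if every $P\in\mathcal{P}$ satisfies $P(x,y)=P(y,x)$. An $\textsc{Equality}$-oracle protocol for an $N\times N$ matrix $P$ is a deterministic protocol tree where each inner node $v$ has functions $a_v,b_v\colon[N]\to\mathbb{N}$ and on input $(x,y)$ branches according to whether $a_v(x)=b_v(y)$, and leaves are labeled by outputs; its cost is the tree depth. $\mathcal{P}$ has a constant-cost tandem $\textsc{Equality}$ protocol if there is a constant $c_0$ such that every $P\in\mathcal{P}$ has such a protocol of cost at most $c_0$ with $a_v=b_v$ at every node $v$. Distance-$r$ composition: for $P_1,\dots,P_n\in\mathcal{P}$, inputs $x=(x_1,\dots,x_n)$, $y=(y_1,\dots,y_n)$ with $x_i,y_i$ row/column indices of $P_i$, and permutation-invariant $g\colon\Lambda^{\le r}\to\Lambda$ (i.e. $g(u)=g(v)$ when $v$ is a permutation of $u$), $g[P_1\bullet\cdots\bullet P_n](x,y)=\bot$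 if more than $r$ indices $i$ have $x_i\ne y_i$, and otherwise equals $g$ applied to the sequence $(P_i(x_i,y_i): x_i\neq y_i)$. $\textsc{HD}_k$ is the family of matrices $\textsc{HD}_k^t(u,v)=1$ iff the Hamming distance of $u,v\in\{0,1\}^t$ is $k$. For a problem $P\colon\mathcal{X}\times\mathcal{Y}\to\Lambda'$, $\mathsf{D}^{\textsc{HD}_k}(P)$ is the minimum depth of a deterministic protocol tree whose inner nodes $v$ query a bit $\textsc{HD}_k^t(\phi_v(x),\psi_v(y))$ for some $t$ and maps $\phi_v,\psi_v$ into $\{0,1\}^t$, whose leaves are labeled by elements of $\Lambda'$, and which outputs $P(x,y)$ on every input. -}

module Defs where

open import Data.Nat using (ℕ; zero; suc; _≤_; _+_; _<ᵇ_)
open import Data.Nat.Properties using (_≟_)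
open import Data.Fin using (Fin) renaming (zero to fz; suc to fs)
import Data.Fin.Properties as FinP
open import Data.Bool using (Bool; true; false; if_then_else_)
open import Data.Vec using (Vec; []; _∷_)
open import Data.List using (List; []; _∷_; _++_; length)
open import Data.Maybe using (Maybe; just; nothing)
open import Data.Product using (Σ; _×_; ∃)
open import Data.List.Relation.Binary.Permutation.Propositional using (_↭_)
open import Relation.Nullary using (yes; no; does)
open import Relation.Binary.PropositionalEquality using (_≡_)

-- Alphabet Λ is Fin m.  An N×N Λ-valued matrix.
Matrix : ℕ → ℕ → Set
Matrix m N = Fin N → Fin N → Fin m

Family : ℕ → Set₁
Family m = (N : ℕ) → Matrix m N → Set

SymmetricFamily : ∀ {m} → Family m → Set
SymmetricFamily {m} 𝒫 = ∀ N (P : Matrix m N) → 𝒫 N P → ∀ x y → P x y ≡ P y x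

-- Tandem Equality-oracle protocol trees (a_v = b_v at every node).
data TandemEqProt (N : ℕ) (Out : Set) : Set where
  leaf : Out → TandemEqProt N Out
  node : (a : Fin N → ℕ) → (ifEq ifNeq : TandemEqProt N Out) → TandemEqProt N Out

depthT : ∀ {N Out} → TandemEqProt N Out → ℕ
depthT (leaf _) = 0
depthT (node _ l r) = suc (Data.Nat._⊔_ (depthT l) (depthT r))

evalT : ∀ {N Out} → TandemEqProt N Out → Fin N → Fin N → Out
evalT (leaf o) x y = o
evalT (node a l r) x y = if does (a x ≟ a y) then evalT l x y else evalT r x y

ConstCostTandemEq : ∀ {m} → Family m → Set
ConstCostTandemEq {m} 𝒫 =
  Σ ℕ λ c₀ → ∀ N (P : Matrix m N) → 𝒫 N P →
    Σ (TandemEqProt N (Fin m)) λ π → depthT π ≤ c₀ × (∀ x y → evalT π x y ≡ P x y)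

-- g : Λ^{≤ r} → Λ, represented as a function on lists whose values on lists
-- of length > r are irrelevant; permutation invariance on Λ^{≤ r}.
PermInvariant : ∀ {m} → ℕ → (List (Fin m) → Fin m) → Set
PermInvariant {m} r g = ∀ (u v : List (Fin m)) → length u ≤ r → u ↭ v → g u ≡ g v

Input : (n : ℕ) → (Fin n → ℕ) → Set
Input n Ns = (i : Fin n) → Fin (Ns i)

diffs : ∀ {m} (n : ℕ) (Ns : Fin n → ℕ) → ((i : Fin n) → Matrix m (Ns i)) →
        Input n Ns → Input n Ns → List (Fin m)
diffs zero Ns Ps x y = []
diffs (suc n) Ns Ps x y =
  (if does (FinP._≟_ (x fz) (y fz)) then [] else (Ps fz (x fz) (y fz) ∷ []))
  ++ diffs n (λ i → Ns (fs i)) (λ i → Ps (fs i)) (λ i → x (fs i)) (λ i → y (fs i))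

-- Distance-r composition g[P_1 • ... • P_n]; nothing = ⊥.
composition : ∀ {m} (r : ℕ) (g : List (Fin m) → Fin m) (n : ℕ) (Ns : Fin n → ℕ) →
              ((i : Fin n) → Matrix m (Ns i)) → Input n Ns → Input n Ns → Maybe (Fin m)
composition r g n Ns Ps x y with diffs n Ns Ps x y
... | d = if r Data.Nat.<ᵇ length d then nothing else just (g d)

hamming : ∀ {t} → Vec Bool t → Vec Bool t → ℕ
hamming [] [] = 0
hamming (a ∷ u) (b ∷ v) = (if does (Data.Bool._≟_ a b) then 0 else 1) + hamming u v

HD : ℕ → ∀ {t} → Vec Bool t → Vec Bool t → Bool
HD k u v = does (hamming u v ≟ k)

data HDProt (k : ℕ) (X Y Out : Set) : Set where
  leaf : Out → HDProt k X Y Out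
  node : (t : ℕ) → (φ : X → Vec Bool t) → (ψ : Y → Vec Bool t) →
         (if1 if0 : HDProt k X Y Out) → HDProt k X Y Out

depthHD : ∀ {k X Y Out} → HDProt k X Y Out → ℕ
depthHD (leaf _) = 0
depthHD (node _ _ _ l r) = suc (Data.Nat._⊔_ (depthHD l) (depthHD r))

evalHD : ∀ {k X Y Out} → HDProt k X Y Out → X → Y → Out
evalHD (leaf o) x y = o
evalHD {k} (node t φ ψ l r) x y = if HD k (φ x) (ψ y) then evalHD l x y else evalHD r x y

{-# OPTIONS --safe #-}
-- Encode the value of a coordinate-wise feature at each coordinate by the one-hot vector
-- of its class representative.  The Hamming distance of two encodings is then twice the
-- number of coordinates on which the feature differs, so after padding with 2(r - j)
-- mismatched bits a single HD_{2r} query asks whether that number is j, and the queries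
-- j = 0, ..., r compute it capped at r + 1.  The capped value is exact for every feature
-- as soon as x and y differ in at most r coordinates; otherwise the answer is ⊥ anyway.
-- Walking the tandem trees of all coordinates in lockstep, a coordinate goes left at a
-- node iff it agrees on the node's function, so the number of differing coordinates whose
-- tree outputs ℓ is an inclusion-exclusion combination of 2·3^c₀ such feature counts.
-- These multiplicities determine the multiset of values P_i(x_i, y_i), which is all a
-- permutation-invariant g depends on.
module Submission where

open import Defs
open import Data.Nat using (ℕ; _≤_)
open import Data.Fin using (Fin)
open import Data.List using (List)
open import Data.Maybe using (Maybe)
open import Data.Product using (Σ; _×_)
open import Relation.Binary.PropositionalEquality using (_≡_)

open import Data.Bool using (Bool; true; false; if_then_else_; not; _∧_)
open import Data.Bool.Properties using (T-≡; ∧-identityʳ) renaming (_≟_ to _≟ᵇ_)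
open import Data.Fin using (zero; suc; toℕ)
open import Data.Fin.Properties using (any?; toℕ-injective) renaming (_≟_ to _≟ᶠ_)
open import Data.List using ([]; _∷_; _++_; length; map; replicate)
open import Data.List.Properties using (≡-dec; length-++)
open import Data.List.Relation.Binary.Permutation.Propositional
  using (_↭_; prep; ↭-refl; ↭-sym; ↭-trans; ↭-reflexive)
import Data.List.Relation.Binary.Permutation.Propositional.Properties as ↭
open import Data.Maybe using (just; nothing)
open import Data.Nat using (zero; suc; _+_; _*_; _∸_; _⊓_; _<_; _<ᵇ_; z≤n; s≤s; s≤s⁻¹)
open import Data.Nat.Properties
  using ( _≟_; _≤?_; ≤-refl; ≤-trans; ≤-reflexive; +-identityʳ; +-comm; +-assoc; +-suc
        ; +-monoˡ-≤; +-mono-≤; m≤m+n; m≤n⇒m≤1+n; ≤∧≢⇒<; ≰⇒>; <ᵇ⇒<; <⇒<ᵇ; ≤⇒≯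
        ; m+n∸n≡m; m+[n∸m]≡n; +-cancelʳ-≡; *-cancelˡ-≡; *-distribˡ-+
        ; m⊓n≤m; m≤n⇒m⊓n≡m; m≥n⇒m⊓n≡n; ⊓-glb; ⊔-mono-≤; +-distribʳ-⊔; m≤m⊔n; m≤n⊔m; +-*-semiring )
open import Algebra.Properties.Semiring.Sum +-*-semiring using (sum; sum-cong-≗; ∑-distrib-+)
open import Data.Product using (_,_; proj₁; proj₂; ∃)
open import Data.Vec using (Vec; []; _∷_)
import Data.Vec as Vec
open import Function using (_∘_; _⇔_; mk⇔; Equivalence)
open import Relation.Binary using (DecidableEquality)
open import Relation.Binary.PropositionalEquality
  using (refl; sym; trans; cong; cong₂; subst; module ≡-Reasoning)
open import Relation.Nullary using (Dec; yes; no; does; contradiction)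
open import Relation.Nullary.Decidable using (does-⇔; dec-true; dec-false)

private
  variable
    k m n N M c c₁ c₂ d e j r : ℕ
    X Y A B C : Set
    Ns : Fin n → ℕ

-- Protocols with HD_k queries

record Computes (k : ℕ) {X A : Set} (f : X → X → A) (cost : ℕ) : Set where
  field
    protocol         : HDProt k X X A
    protocol-depth   : depthHD protocol ≤ cost
    protocol-correct : ∀ x y → evalHD protocol x y ≡ f x y
open Computes

graft : HDProt k X Y A → (A → HDProt k X Y B) → HDProt k X Y B
graft (leaf a)         κ = κ a
graft (node t φ ψ l r) κ = node t φ ψ (graft l κ) (graft r κ)

evalHD-graft : (π : HDProt k X Y A) (κ : A → HDProt k X Y B) (x : X) (y : Y) →
               evalHD (graft π κ) x y ≡ evalHD (κ (evalHD π x y)) x y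
evalHD-graft         (leaf a)         κ x y = refl
evalHD-graft {k = k} (node t φ ψ l r) κ x y with HD k (φ x) (ψ y)
... | true  = evalHD-graft l κ x y
... | false = evalHD-graft r κ x y

depthHD-graft : (π : HDProt k X Y A) {κ : A → HDProt k X Y B} →
                (∀ a → depthHD (κ a) ≤ c) → depthHD (graft π κ) ≤ depthHD π + c
depthHD-graft         (leaf a)         κ≤ = κ≤ a
depthHD-graft {c = c} (node t φ ψ l r) κ≤ =
  s≤s (≤-trans (⊔-mono-≤ (depthHD-graft l κ≤) (depthHD-graft r κ≤))
               (≤-reflexive (sym (+-distribʳ-⊔ c (depthHD l) (depthHD r)))))

pureᶜ : (a : A) → Computes k {X} (λ _ _ → a) 0
pureᶜ a = record { protocol = leaf a ; protocol-depth = z≤n ; protocol-correct = λ _ _ → refl }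

queryᶜ : (φ ψ : X → Vec Bool N) → Computes k (λ x y → HD k (φ x) (ψ y)) 1
queryᶜ {N = N} {k = k} φ ψ = record
  { protocol         = node N φ ψ (leaf true) (leaf false)
  ; protocol-depth   = s≤s z≤n
  ; protocol-correct = answer
  }
  where
  answer : ∀ x y → (if HD k (φ x) (ψ y) then true else false) ≡ HD k (φ x) (ψ y)
  answer x y with HD k (φ x) (ψ y)
  ... | true  = refl
  ... | false = refl

map₂ᶜ : (h : A → B → C) {f : X → X → A} {g : X → X → B} →
        Computes k f c₁ → Computes k g c₂ → Computes k (λ x y → h (f x y) (g x y)) (c₁ + c₂)
map₂ᶜ {A = A} {C = C} {X = X} {k = k} {c₁ = c₁} {c₂ = c₂} h F G = record
  { protocol         = graft (protocol F) inner
  ; protocol-depth   = ≤-trans (depthHD-graft (protocol F) inner-depth) (+-monoˡ-≤ c₂ (protocol-depth F))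
  ; protocol-correct = λ x y →
      trans (evalHD-graft (protocol F) inner x y)
     (trans (evalHD-graft (protocol G) _ x y)
            (cong₂ h (protocol-correct F x y) (protocol-correct G x y)))
  }
  where
  inner : A → HDProt k X X C
  inner a = graft (protocol G) (λ b → leaf (h a b))
  inner-depth : ∀ a → depthHD (inner a) ≤ c₂
  inner-depth a = ≤-trans (depthHD-graft (protocol G) (λ _ → z≤n))
                          (≤-trans (≤-reflexive (+-identityʳ _)) (protocol-depth G))

Computes-cong : {f g : X → X → A} → (∀ x y → f x y ≡ g x y) → Computes k f c → Computes k g c
Computes-cong f≗g F = record
  { protocol         = protocol F
  ; protocol-depth   = protocol-depth F
  ; protocol-correct = λ x y → trans (protocol-correct F x y) (f≗g x y)
  }

-- Features and the Hamming distances of their encodings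

mismatch : {P : Set} → Dec P → ℕ
mismatch P? = if does P? then 0 else 1

mismatch-cong : {P Q : Set} (P? : Dec P) (Q? : Dec Q) → does P? ≡ does Q? → mismatch P? ≡ mismatch Q?
mismatch-cong _ _ = cong (λ b → if b then 0 else 1)

oneHot : Fin N → Vec Bool N
oneHot {suc N} zero    = true ∷ Vec.replicate N false
oneHot         (suc i) = false ∷ oneHot i

hamming-self : (u : Vec Bool N) → hamming u u ≡ 0
hamming-self []          = refl
hamming-self (true ∷ u)  = hamming-self u
hamming-self (false ∷ u) = hamming-self u

hamming-falses-oneHot : (i : Fin N) → hamming (Vec.replicate N false) (oneHot i) ≡ 1
hamming-falses-oneHot {suc N} zero    = cong suc (hamming-self (Vec.replicate N false))
hamming-falses-oneHot         (suc i) = hamming-falses-oneHot i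

hamming-oneHot-falses : (i : Fin N) → hamming (oneHot i) (Vec.replicate N false) ≡ 1
hamming-oneHot-falses {suc N} zero    = cong suc (hamming-self (Vec.replicate N false))
hamming-oneHot-falses         (suc i) = hamming-oneHot-falses i

hamming-oneHot : (a b : Fin N) → hamming (oneHot a) (oneHot b) ≡ 2 * mismatch (a ≟ᶠ b)
hamming-oneHot {suc N} zero    zero    = hamming-self (Vec.replicate N false)
hamming-oneHot         zero    (suc b) = cong suc (hamming-falses-oneHot b)
hamming-oneHot         (suc a) zero    = cong suc (hamming-oneHot-falses a)
hamming-oneHot         (suc a) (suc b) = hamming-oneHot a b

hamming-++ : (u u′ : Vec Bool N) (v v′ : Vec Bool M) →
             hamming (u Vec.++ v) (u′ Vec.++ v′) ≡ hamming u u′ + hamming v v′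
hamming-++ []      []        v v′ = refl
hamming-++ (a ∷ u) (a′ ∷ u′) v v′ =
  trans (cong (mismatch (a ≟ᵇ a′) +_) (hamming-++ u u′ v v′))
        (sym (+-assoc (mismatch (a ≟ᵇ a′)) (hamming u u′) (hamming v v′)))

hamming-trues-falses : (p : ℕ) → hamming (Vec.replicate p true) (Vec.replicate p false) ≡ p
hamming-trues-falses zero    = refl
hamming-trues-falses (suc p) = cong suc (hamming-trues-falses p)

module _ {A : Set} (_≟ᴬ_ : DecidableEquality A) {N : ℕ} (f : Fin N → A) where

  private
    pick : (v : A) → ∃ (λ z → f z ≡ v) → Fin N
    pick v w with any? (λ z → f z ≟ᴬ v)
    ... | yes (z , _) = z
    ... | no ∄z       = contradiction w ∄z

    pick-correct : ∀ v w → f (pick v w) ≡ v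
    pick-correct v w with any? (λ z → f z ≟ᴬ v)
    ... | yes (_ , fz≡v) = fz≡v
    ... | no ∄z          = contradiction w ∄z

    pick-cong : ∀ {v v′} → v ≡ v′ → ∀ w w′ → pick v w ≡ pick v′ w′
    pick-cong {v} refl w w′ with any? (λ z → f z ≟ᴬ v)
    ... | yes _ = refl
    ... | no ∄z = contradiction w ∄z

  representative : Fin N → Fin N
  representative a = pick (f a) (a , refl)

  representative-≟ : ∀ a b → does (representative a ≟ᶠ representative b) ≡ does (f a ≟ᴬ f b)
  representative-≟ a b =
    does-⇔ (mk⇔ same-value same-representative) (representative a ≟ᶠ representative b) (f a ≟ᴬ f b)
    where
    same-value : representative a ≡ representative b → f a ≡ f b
    same-value eq = trans (sym (pick-correct _ _)) (trans (cong f eq) (pick-correct _ _))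
    same-representative : f a ≡ f b → representative a ≡ representative b
    same-representative eq = pick-cong eq (a , refl) (b , refl)

Feature : (n : ℕ) → (Fin n → ℕ) → Set
Feature n Ns = (i : Fin n) → Fin (Ns i) → List ℕ

_≟ₗ_ : DecidableEquality (List ℕ)
_≟ₗ_ = ≡-dec _≟_

mismatchOn : (Fin N → List ℕ) → Fin N → Fin N → ℕ
mismatchOn G a b = mismatch (G a ≟ₗ G b)

dist : Feature n Ns → Input n Ns → Input n Ns → ℕ
dist F x y = sum (λ i → mismatchOn (F i) (x i) (y i))

_∷ᶠ_ : (Fin N → ℕ) → (Fin N → List ℕ) → Fin N → List ℕ
(f ∷ᶠ G) z = f z ∷ G z

blank : Feature n Ns
blank _ _ = []

withPosition : Feature n Ns → Feature n Ns
withPosition F i = toℕ ∷ᶠ F i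

position : Feature n Ns
position = withPosition blank

toℕ-≟ : (a b : Fin N) → does (toℕ a ≟ toℕ b) ≡ does (a ≟ᶠ b)
toℕ-≟ a b = does-⇔ (mk⇔ toℕ-injective (cong toℕ)) (toℕ a ≟ toℕ b) (a ≟ᶠ b)

mismatch-position : (a b : Fin N) → mismatchOn (toℕ ∷ᶠ (λ _ → [])) a b ≡ mismatch (a ≟ᶠ b)
mismatch-position a b =
  mismatch-cong ((toℕ a ∷ []) ≟ₗ (toℕ b ∷ [])) (a ≟ᶠ b) (trans (∧-identityʳ _) (toℕ-≟ a b))

mismatch≤1 : {P : Set} (P? : Dec P) → mismatch P? ≤ 1
mismatch≤1 P? with does P?
... | true  = z≤n
... | false = s≤s z≤n

mismatchOn≤mismatch : (G : Fin N → List ℕ) (a b : Fin N) → mismatchOn G a b ≤ mismatch (a ≟ᶠ b)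
mismatchOn≤mismatch G a b with a ≟ᶠ b
... | yes refl rewrite dec-true (G a ≟ₗ G a) refl = z≤n
... | no _     = mismatch≤1 (G a ≟ₗ G b)

sum-mono-≤ : {f g : Fin n → ℕ} → (∀ i → f i ≤ g i) → sum f ≤ sum g
sum-mono-≤ {n = zero}  f≤g = z≤n
sum-mono-≤ {n = suc n} f≤g = +-mono-≤ (f≤g zero) (sum-mono-≤ (f≤g ∘ suc))

dist≤dist-position : (F : Feature n Ns) (x y : Input n Ns) → dist F x y ≤ dist position x y
dist≤dist-position F x y = sum-mono-≤ λ i →
  ≤-trans (mismatchOn≤mismatch (F i) (x i) (y i)) (≤-reflexive (sym (mismatch-position (x i) (y i))))

encode : Feature n Ns → Input n Ns → Vec Bool (sum Ns)
encode {n = zero}  F x = []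
encode {n = suc n} F x =
  oneHot (representative _≟ₗ_ (F zero) (x zero)) Vec.++ encode (λ i → F (suc i)) (λ i → x (suc i))

hamming-encode : (F : Feature n Ns) (x y : Input n Ns) → hamming (encode F x) (encode F y) ≡ 2 * dist F x y
hamming-encode {n = zero}  F x y = refl
hamming-encode {n = suc n} {Ns} F x y = begin
  hamming (encode F x) (encode F y)
    ≡⟨ hamming-++ (oneHot (rep x₀)) (oneHot (rep y₀)) (encode F′ x′) (encode F′ y′) ⟩
  hamming (oneHot (rep x₀)) (oneHot (rep y₀)) + hamming (encode F′ x′) (encode F′ y′)
    ≡⟨ cong₂ _+_ hamming-head (hamming-encode F′ x′ y′) ⟩
  2 * mismatchOn (F zero) x₀ y₀ + 2 * dist F′ x′ y′
    ≡⟨ *-distribˡ-+ 2 (mismatchOn (F zero) x₀ y₀) (dist F′ x′ y′) ⟨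
  2 * dist F x y ∎
  where
  open ≡-Reasoning
  rep : Fin (Ns zero) → Fin (Ns zero)
  rep = representative _≟ₗ_ (F zero)
  x₀ y₀ : Fin (Ns zero)
  x₀ = x zero
  y₀ = y zero
  F′ : Feature n (Ns ∘ suc)
  F′ i = F (suc i)
  x′ y′ : Input n (Ns ∘ suc)
  x′ i = x (suc i)
  y′ i = y (suc i)
  hamming-head : hamming (oneHot (rep x₀)) (oneHot (rep y₀)) ≡ 2 * mismatchOn (F zero) x₀ y₀
  hamming-head =
    trans (hamming-oneHot (rep x₀) (rep y₀))
          (cong (2 *_) (mismatch-cong (rep x₀ ≟ᶠ rep y₀) (F zero x₀ ≟ₗ F zero y₀)
                                      (representative-≟ _≟ₗ_ (F zero) x₀ y₀)))

2*[m+[n∸o]]≡2*n⇔m≡o : ∀ {m n o} → o ≤ n → (2 * (m + (n ∸ o)) ≡ 2 * n) ⇔ (m ≡ o)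
2*[m+[n∸o]]≡2*n⇔m≡o {m} {n} {o} o≤n = mk⇔ to from
  where
  to : 2 * (m + (n ∸ o)) ≡ 2 * n → m ≡ o
  to eq = +-cancelʳ-≡ (n ∸ o) m o (trans (*-cancelˡ-≡ _ _ 2 eq) (sym (m+[n∸m]≡n o≤n)))
  from : m ≡ o → 2 * (m + (n ∸ o)) ≡ 2 * n
  from refl = cong (2 *_) (m+[n∸m]≡n o≤n)

dist-queryᶜ : (F : Feature n Ns) → j ≤ r → Computes (2 * r) (λ x y → does (dist F x y ≟ j)) 1
dist-queryᶜ {n = n} {Ns} {j} {r} F j≤r = Computes-cong answer (queryᶜ (padded true) (padded false))
  where
  padded : Bool → Input n Ns → Vec Bool (sum Ns + 2 * (r ∸ j))
  padded b x = encode F x Vec.++ Vec.replicate (2 * (r ∸ j)) b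
  answer : ∀ x y → HD (2 * r) (padded true x) (padded false y) ≡ does (dist F x y ≟ j)
  answer x y = begin
    does (hamming (padded true x) (padded false y) ≟ 2 * r)
      ≡⟨ cong (λ h → does (h ≟ 2 * r)) hamming-padded ⟩
    does (2 * (dist F x y + (r ∸ j)) ≟ 2 * r)
      ≡⟨ does-⇔ (2*[m+[n∸o]]≡2*n⇔m≡o j≤r) (2 * (dist F x y + (r ∸ j)) ≟ 2 * r) (dist F x y ≟ j) ⟩
    does (dist F x y ≟ j) ∎
    where
    open ≡-Reasoning
    hamming-padded : hamming (padded true x) (padded false y) ≡ 2 * (dist F x y + (r ∸ j))
    hamming-padded = begin
      hamming (padded true x) (padded false y)
        ≡⟨ hamming-++ (encode F x) (encode F y) (Vec.replicate _ true) (Vec.replicate _ false) ⟩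
      hamming (encode F x) (encode F y) + hamming (Vec.replicate (2 * (r ∸ j)) true) (Vec.replicate _ false)
        ≡⟨ cong₂ _+_ (hamming-encode F x y) (hamming-trues-falses (2 * (r ∸ j))) ⟩
      2 * dist F x y + 2 * (r ∸ j)
        ≡⟨ *-distribˡ-+ 2 (dist F x y) (r ∸ j) ⟨
      2 * (dist F x y + (r ∸ j)) ∎

searchFrom : ℕ → ℕ → ℕ → ℕ
searchFrom j zero    d = j
searchFrom j (suc e) d = if does (d ≟ j) then j else searchFrom (suc j) e d

searchFrom-⊓ : j ≤ d → searchFrom j e d ≡ d ⊓ (j + e)
searchFrom-⊓ {j} {d} {zero} j≤d = trans (sym (m≥n⇒m⊓n≡n j≤d)) (cong (d ⊓_) (sym (+-identityʳ j)))
searchFrom-⊓ {j} {d} {suc e} j≤d with d ≟ j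
... | yes refl rewrite dec-true (d ≟ d) refl = sym (m≤n⇒m⊓n≡m (m≤m+n d (suc e)))
... | no d≢j   rewrite dec-false (d ≟ j) d≢j =
  trans (searchFrom-⊓ (≤∧≢⇒< j≤d (d≢j ∘ sym))) (cong (d ⊓_) (sym (+-suc j e)))

searchFromᶜ : {f : X → X → ℕ} → (∀ i → i ≤ r → Computes k (λ x y → does (f x y ≟ i)) 1) →
              ∀ j e → j + e ≤ suc r → Computes k (λ x y → searchFrom j e (f x y)) e
searchFromᶜ         queries j zero    _    = pureᶜ j
searchFromᶜ {r = r} queries j (suc e) j+e≤ =
  map₂ᶜ (λ found rest → if found then j else rest)
        (queries j (≤-trans (m≤m+n j e) (s≤s⁻¹ j+e<)))
        (searchFromᶜ queries (suc j) e j+e<)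
  where
  j+e< : suc (j + e) ≤ suc r
  j+e< = subst (_≤ suc r) (+-suc j e) j+e≤

cappedᶜ : {f : X → X → ℕ} → (∀ i → i ≤ r → Computes k (λ x y → does (f x y ≟ i)) 1) →
          Computes k (λ x y → f x y ⊓ suc r) (suc r)
cappedᶜ {r = r} queries =
  Computes-cong (λ x y → searchFrom-⊓ z≤n) (searchFromᶜ queries 0 (suc r) ≤-refl)

dist-cappedᶜ : (F : Feature n Ns) → Computes (2 * r) (λ x y → dist F x y ⊓ suc r) (suc r)
dist-cappedᶜ F = cappedᶜ (λ j j≤r → dist-queryᶜ F j≤r)

-- Counting along tandem trees

⟦_⟧ : Bool → ℕ
⟦ b ⟧ = if b then 1 else 0

-- A leaf o acts as a node querying a constant function, with leaf o as both children;
-- this lets trees of different shapes be unfolded in lockstep.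
root : TandemEqProt N A → Fin N → ℕ
root (leaf _)     _ = 0
root (node a _ _)   = a

left right : TandemEqProt N A → TandemEqProt N A
left  (leaf o)     = leaf o
left  (node _ l _) = l
right (leaf o)     = leaf o
right (node _ _ r) = r

depthT-left : (t : TandemEqProt N A) → depthT t ≤ suc d → depthT (left t) ≤ d
depthT-left (leaf _)     _ = z≤n
depthT-left (node _ l r) t≤ = ≤-trans (m≤m⊔n (depthT l) (depthT r)) (s≤s⁻¹ t≤)

depthT-right : (t : TandemEqProt N A) → depthT t ≤ suc d → depthT (right t) ≤ d
depthT-right (leaf _)     _ = z≤n
depthT-right (node _ l r) t≤ = ≤-trans (m≤n⊔m (depthT l) (depthT r)) (s≤s⁻¹ t≤)

labelled : Fin m → TandemEqProt N (Fin m) → Bool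
labelled ℓ (leaf o)     = does (o ≟ᶠ ℓ)
labelled ℓ (node _ _ _) = false

mask : Bool → (Fin N → List ℕ) → Fin N → List ℕ
mask s G z = if s then G z else []

hit : Fin m → (Fin N → List ℕ) → TandemEqProt N (Fin m) → Fin N → Fin N → ℕ
hit ℓ G t a b = ⟦ does (G a ≟ₗ G b) ∧ not (does (a ≟ᶠ b)) ∧ does (evalT t a b ≟ᶠ ℓ) ⟧

hit-split : (ℓ : Fin m) (G : Fin N → List ℕ) (t : TandemEqProt N (Fin m)) (a b : Fin N) →
            hit ℓ G t a b + hit ℓ (root t ∷ᶠ G) (right t) a b ≡
            hit ℓ (root t ∷ᶠ G) (left t) a b + hit ℓ G (right t) a b
hit-split ℓ G (leaf o) a b = +-comm (hit ℓ G (leaf o) a b) _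
hit-split ℓ G (node f l r) a b with does (f a ≟ f b)
... | true  = refl
... | false = +-identityʳ _

hit-leaf : (ℓ : Fin m) (G : Fin N → List ℕ) (t : TandemEqProt N (Fin m)) → depthT t ≤ 0 →
           (a b : Fin N) →
           hit ℓ G t a b + mismatchOn (mask (labelled ℓ t) G) a b ≡
           mismatchOn (mask (labelled ℓ t) (toℕ ∷ᶠ G)) a b
hit-leaf ℓ G (leaf o) _ a b with does (o ≟ᶠ ℓ)
... | false with does (G a ≟ₗ G b) | does (a ≟ᶠ b)
...   | false | _     = refl
...   | true  | false = refl
...   | true  | true  = refl
hit-leaf ℓ G (leaf o) _ a b | true rewrite toℕ-≟ a b with does (G a ≟ₗ G b) | does (a ≟ᶠ b)
...   | false | false = refl
...   | false | true  = refl
...   | true  | false = refl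
...   | true  | true  = refl

Trees : (m n : ℕ) → (Fin n → ℕ) → Set
Trees m n Ns = (i : Fin n) → TandemEqProt (Ns i) (Fin m)

hits : Fin m → Feature n Ns → Trees m n Ns → Input n Ns → Input n Ns → ℕ
hits ℓ F t x y = sum (λ i → hit ℓ (F i) (t i) (x i) (y i))

descend : Trees m n Ns → Feature n Ns → Feature n Ns
descend t F i = root (t i) ∷ᶠ F i

masked : Fin m → Trees m n Ns → Feature n Ns → Feature n Ns
masked ℓ t F i = mask (labelled ℓ (t i)) (F i)

-- δ F stands for dist F x y; keeping it abstract lets the protocol evaluate the same
-- expression with distances capped at r + 1.
estimate : (Feature n Ns → ℕ) → Fin m → ℕ → Feature n Ns → Trees m n Ns → ℕ
estimate δ ℓ zero    F t = δ (masked ℓ t (withPosition F)) ∸ δ (masked ℓ t F)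
estimate δ ℓ (suc d) F t =
  (estimate δ ℓ d (descend t F) (left ∘ t) + estimate δ ℓ d F (right ∘ t))
  ∸ estimate δ ℓ d (descend t F) (right ∘ t)

estimateCost : ℕ → ℕ → ℕ
estimateCost c zero    = c + c
estimateCost c (suc d) = (estimateCost c d + estimateCost c d) + estimateCost c d

∑-+-cong : (f g h : Fin n → ℕ) → (∀ i → f i + g i ≡ h i) → sum f + sum g ≡ sum h
∑-+-cong f g h eq = trans (sym (∑-distrib-+ f g)) (sum-cong-≗ eq)

estimate-correct : {δ : Feature n Ns → ℕ} {x y : Input n Ns} → (∀ F → δ F ≡ dist F x y) →
                   (ℓ : Fin m) (d : ℕ) (F : Feature n Ns) (t : Trees m n Ns) → (∀ i → depthT (t i) ≤ d) →
                   estimate δ ℓ d F t ≡ hits ℓ F t x y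
estimate-correct {δ = δ} {x} {y} δ≗dist ℓ zero F t leaves = begin
  δ (masked ℓ t (withPosition F)) ∸ δ (masked ℓ t F)
    ≡⟨ cong₂ _∸_ (δ≗dist _) (δ≗dist _) ⟩
  dist (masked ℓ t (withPosition F)) x y ∸ dist (masked ℓ t F) x y
    ≡⟨ cong (_∸ dist (masked ℓ t F) x y)
            (∑-+-cong _ _ _ (λ i → hit-leaf ℓ (F i) (t i) (leaves i) (x i) (y i))) ⟨
  hits ℓ F t x y + dist (masked ℓ t F) x y ∸ dist (masked ℓ t F) x y
    ≡⟨ m+n∸n≡m (hits ℓ F t x y) (dist (masked ℓ t F) x y) ⟩
  hits ℓ F t x y ∎
  where open ≡-Reasoning
estimate-correct {n = n} {Ns} {δ = δ} {x} {y} δ≗dist ℓ (suc d) F t depth≤ = begin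
  (estimate δ ℓ d F′ (left ∘ t) + estimate δ ℓ d F (right ∘ t)) ∸ estimate δ ℓ d F′ (right ∘ t)
    ≡⟨ cong₂ _∸_ (cong₂ _+_ (estimate-correct δ≗dist ℓ d F′ (left ∘ t) left≤)
                            (estimate-correct δ≗dist ℓ d F (right ∘ t) right≤))
                 (estimate-correct δ≗dist ℓ d F′ (right ∘ t) right≤) ⟩
  (hits ℓ F′ (left ∘ t) x y + hits ℓ F (right ∘ t) x y) ∸ hits ℓ F′ (right ∘ t) x y
    ≡⟨ cong (_∸ hits ℓ F′ (right ∘ t) x y) split ⟨
  hits ℓ F t x y + hits ℓ F′ (right ∘ t) x y ∸ hits ℓ F′ (right ∘ t) x y
    ≡⟨ m+n∸n≡m (hits ℓ F t x y) (hits ℓ F′ (right ∘ t) x y) ⟩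
  hits ℓ F t x y ∎
  where
  open ≡-Reasoning
  F′ : Feature n Ns
  F′ = descend t F
  left≤ : ∀ i → depthT (left (t i)) ≤ d
  left≤ i = depthT-left (t i) (depth≤ i)
  right≤ : ∀ i → depthT (right (t i)) ≤ d
  right≤ i = depthT-right (t i) (depth≤ i)
  split : hits ℓ F t x y + hits ℓ F′ (right ∘ t) x y ≡ hits ℓ F′ (left ∘ t) x y + hits ℓ F (right ∘ t) x y
  split = trans (∑-+-cong _ _ _ (λ i → hit-split ℓ (F i) (t i) (x i) (y i)))
                (∑-distrib-+ (λ i → hit ℓ (F′ i) (left (t i)) (x i) (y i))
                             (λ i → hit ℓ (F i) (right (t i)) (x i) (y i)))

estimateᶜ : {δ : X → X → Feature n Ns → ℕ} → (∀ F → Computes k (λ x y → δ x y F) c) →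
            (ℓ : Fin m) (d : ℕ) (F : Feature n Ns) (t : Trees m n Ns) →
            Computes k (λ x y → estimate (δ x y) ℓ d F t) (estimateCost c d)
estimateᶜ δᶜ ℓ zero    F t = map₂ᶜ _∸_ (δᶜ (masked ℓ t (withPosition F))) (δᶜ (masked ℓ t F))
estimateᶜ δᶜ ℓ (suc d) F t =
  map₂ᶜ _∸_ (map₂ᶜ _+_ (estimateᶜ δᶜ ℓ d (descend t F) (left ∘ t)) (estimateᶜ δᶜ ℓ d F (right ∘ t)))
            (estimateᶜ δᶜ ℓ d (descend t F) (right ∘ t))

-- Multisets and the composed problem

multiplicity : Fin m → List (Fin m) → ℕ
multiplicity ℓ []       = 0
multiplicity ℓ (w ∷ ws) = ⟦ does (w ≟ᶠ ℓ) ⟧ + multiplicity ℓ ws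

multiplicity-++ : (ℓ : Fin m) (us vs : List (Fin m)) →
                  multiplicity ℓ (us ++ vs) ≡ multiplicity ℓ us + multiplicity ℓ vs
multiplicity-++ ℓ []       vs = refl
multiplicity-++ ℓ (u ∷ us) vs =
  trans (cong (⟦ does (u ≟ᶠ ℓ) ⟧ +_) (multiplicity-++ ℓ us vs)) (sym (+-assoc ⟦ does (u ≟ᶠ ℓ) ⟧ _ _))

diffAt : Matrix m N → Fin N → Fin N → List (Fin m)
diffAt P a b = if does (a ≟ᶠ b) then [] else P a b ∷ []

length-diffAt : (P : Matrix m N) (a b : Fin N) → length (diffAt P a b) ≡ mismatch (a ≟ᶠ b)
length-diffAt P a b with does (a ≟ᶠ b)
... | true  = refl
... | false = refl

length-diffs : (Ps : (i : Fin n) → Matrix m (Ns i)) (x y : Input n Ns) →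
               length (diffs n Ns Ps x y) ≡ dist position x y
length-diffs {n = zero}  Ps x y = refl
length-diffs {n = suc n} Ps x y =
  trans (length-++ (diffAt (Ps zero) (x zero) (y zero)))
        (cong₂ _+_ (trans (length-diffAt (Ps zero) (x zero) (y zero))
                          (sym (mismatch-position (x zero) (y zero))))
                   (length-diffs (λ i → Ps (suc i)) (λ i → x (suc i)) (λ i → y (suc i))))

multiplicity-diffAt : (P : Matrix m N) (t : TandemEqProt N (Fin m)) → (∀ a b → evalT t a b ≡ P a b) →
                      (ℓ : Fin m) (a b : Fin N) → multiplicity ℓ (diffAt P a b) ≡ hit ℓ (λ _ → []) t a b
multiplicity-diffAt P t t≡P ℓ a b with does (a ≟ᶠ b)
... | true  = refl
... | false rewrite t≡P a b = +-identityʳ _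

multiplicity-diffs : (Ps : (i : Fin n) → Matrix m (Ns i)) (t : Trees m n Ns) →
                     (∀ i a b → evalT (t i) a b ≡ Ps i a b) →
                     (ℓ : Fin m) (x y : Input n Ns) →
                     multiplicity ℓ (diffs n Ns Ps x y) ≡ hits ℓ blank t x y
multiplicity-diffs {n = zero}  Ps t t≡Ps ℓ x y = refl
multiplicity-diffs {n = suc n} Ps t t≡Ps ℓ x y =
  trans (multiplicity-++ ℓ (diffAt (Ps zero) (x zero) (y zero)) _)
        (cong₂ _+_ (multiplicity-diffAt (Ps zero) (t zero) (t≡Ps zero) ℓ (x zero) (y zero))
                   (multiplicity-diffs (λ i → Ps (suc i)) (λ i → t (suc i)) (λ i → t≡Ps (suc i)) ℓ
                                       (λ i → x (suc i)) (λ i → y (suc i))))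

fromCounts : (Fin m → ℕ) → List (Fin m)
fromCounts {m = zero}  c = []
fromCounts {m = suc m} c = replicate (c zero) zero ++ map suc (fromCounts (c ∘ suc))

fromCounts-cong : {c c′ : Fin m → ℕ} → (∀ ℓ → c ℓ ≡ c′ ℓ) → fromCounts c ≡ fromCounts c′
fromCounts-cong {m = zero}  c≗c′ = refl
fromCounts-cong {m = suc m} c≗c′ =
  cong₂ (λ k rest → replicate k zero ++ map suc rest) (c≗c′ zero) (fromCounts-cong (c≗c′ ∘ suc))

fromCounts-0 : fromCounts {m} (λ _ → 0) ≡ []
fromCounts-0 {m = zero}  = refl
fromCounts-0 {m = suc m} = cong (map suc) fromCounts-0

fromCounts-insert : (v : Fin m) (c : Fin m → ℕ) →
                    fromCounts (λ w → ⟦ does (v ≟ᶠ w) ⟧ + c w) ↭ v ∷ fromCounts c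
fromCounts-insert zero    c = ↭-refl
fromCounts-insert (suc v) c =
  ↭-trans (↭.++⁺ˡ (replicate (c zero) zero) (↭.map⁺ suc (fromCounts-insert v (c ∘ suc))))
          (↭.shift (suc v) (replicate (c zero) zero) (map suc (fromCounts (c ∘ suc))))

↭-fromCounts : (ws : List (Fin m)) → ws ↭ fromCounts (λ ℓ → multiplicity ℓ ws)
↭-fromCounts []       = ↭-reflexive (sym fromCounts-0)
↭-fromCounts (w ∷ ws) = ↭-trans (prep w (↭-fromCounts ws)) (↭-sym (fromCounts-insert w _))

fromCountsᶜ : {h : Fin m → X → X → ℕ} → (∀ ℓ → Computes k (h ℓ) c) →
              Computes k (λ x y → fromCounts (λ ℓ → h ℓ x y)) (m * c)
fromCountsᶜ {m = zero}  hᶜ = pureᶜ []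
fromCountsᶜ {m = suc m} hᶜ =
  map₂ᶜ (λ k rest → replicate k zero ++ map suc rest) (hᶜ zero) (fromCountsᶜ (hᶜ ∘ suc))

estimate-capped : (Ps : (i : Fin n) → Matrix m (Ns i)) (t : Trees m n Ns) →
                  (∀ i → depthT (t i) ≤ d) → (∀ i a b → evalT (t i) a b ≡ Ps i a b) →
                  {x y : Input n Ns} → dist position x y ≤ r → (ℓ : Fin m) →
                  estimate (λ F → dist F x y ⊓ suc r) ℓ d blank t ≡ multiplicity ℓ (diffs n Ns Ps x y)
estimate-capped {d = d} {r = r} Ps t depth≤ t≡Ps {x} {y} close ℓ =
  trans (estimate-correct exact ℓ d blank t depth≤) (sym (multiplicity-diffs Ps t t≡Ps ℓ x y))
  where
  exact : ∀ F → dist F x y ⊓ suc r ≡ dist F x y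
  exact F = m≤n⇒m⊓n≡m (m≤n⇒m≤1+n (≤-trans (dist≤dist-position F x y) close))

≤⇒<ᵇ≡false : n ≤ m → (m <ᵇ n) ≡ false
≤⇒<ᵇ≡false {n} {m} n≤m with m <ᵇ n in m<ᵇn
... | false = refl
... | true  = contradiction (<ᵇ⇒< m n (Equivalence.from T-≡ m<ᵇn)) (≤⇒≯ n≤m)

<⇒<ᵇ≡true : m < n → (m <ᵇ n) ≡ true
<⇒<ᵇ≡true = Equivalence.to T-≡ ∘ <⇒<ᵇ

TandemProtocol : ℕ → Matrix m N → Set
TandemProtocol {m} {N} c₀ P =
  Σ (TandemEqProt N (Fin m)) λ π → depthT π ≤ c₀ × (∀ x y → evalT π x y ≡ P x y)

composition-computable :
  (r c₀ : ℕ) {Ps : (i : Fin n) → Matrix m (Ns i)} {g : List (Fin m) → Fin m} → PermInvariant r g →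
  ((i : Fin n) → TandemProtocol c₀ (Ps i)) →
  Computes (2 * r) (composition r g n Ns Ps) (suc r + m * estimateCost (suc r) c₀)
composition-computable {n = n} {m = m} {Ns = Ns} r c₀ {Ps} {g} g-inv tandem =
  Computes-cong correct
    (map₂ᶜ output (dist-cappedᶜ position) (fromCountsᶜ λ ℓ → estimateᶜ dist-cappedᶜ ℓ c₀ blank t))
  where
  t : Trees m n Ns
  t i = proj₁ (tandem i)

  output : ℕ → List (Fin m) → Maybe (Fin m)
  output c ws = if r <ᵇ c then nothing else just (g ws)

  correct : ∀ x y → output (dist position x y ⊓ suc r)
                           (fromCounts (λ ℓ → estimate (λ F → dist F x y ⊓ suc r) ℓ c₀ blank t)) ≡
                    composition r g n Ns Ps x y
  correct x y with dist position x y ≤? r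
  ... | yes close rewrite ≤⇒<ᵇ≡false (≤-trans (m⊓n≤m _ (suc r)) close)
                        | ≤⇒<ᵇ≡false (≤-trans (≤-reflexive (length-diffs Ps x y)) close) =
    cong just (trans (cong g (fromCounts-cong counts)) (sym (g-inv ds _ length≤r (↭-fromCounts ds))))
    where
    ds : List (Fin m)
    ds = diffs n Ns Ps x y
    length≤r : length ds ≤ r
    length≤r = ≤-trans (≤-reflexive (length-diffs Ps x y)) close
    counts : ∀ ℓ → estimate (λ F → dist F x y ⊓ suc r) ℓ c₀ blank t ≡ multiplicity ℓ ds
    counts = estimate-capped Ps t (λ i → proj₁ (proj₂ (tandem i))) (λ i → proj₂ (proj₂ (tandem i))) close
  ... | no far rewrite <⇒<ᵇ≡true (⊓-glb (≰⇒> far) ≤-refl)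
                     | <⇒<ᵇ≡true (≤-trans (≰⇒> far) (≤-reflexive (sym (length-diffs Ps x y)))) = refl

theoremB2 : (m : ℕ) (𝒫 : Family m) → SymmetricFamily 𝒫 → ConstCostTandemEq 𝒫 →
    (r : ℕ) → Σ ℕ λ k → Σ ℕ λ c →
      (n : ℕ) (Ns : Fin n → ℕ) (Ps : (i : Fin n) → Matrix m (Ns i)) →
      ((i : Fin n) → 𝒫 (Ns i) (Ps i)) →
      (g : List (Fin m) → Fin m) → PermInvariant r g →
      Σ (HDProt k (Input n Ns) (Input n Ns) (Maybe (Fin m))) λ π →
        depthHD π ≤ c × ((x y : Input n Ns) → evalHD π x y ≡ composition r g n Ns Ps x y)
theoremB2 m 𝒫 _ (c₀ , tandem) r =
  2 * r , suc r + m * estimateCost (suc r) c₀ ,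
  λ n Ns Ps Ps∈𝒫 g g-inv →
    let C = composition-computable r c₀ g-inv (λ i → tandem (Ns i) (Ps i) (Ps∈𝒫 i))
    in  protocol C , protocol-depth C , protocol-correct C
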